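{- There is an absolute constant $C>0$ such that the following holds. Let $n\ge 1$ be an integer, let $p$ be a prime with $4n < p < 8n$, and let $(a,b,c,d,e)$ be chosen uniformly at random from $\{(a,b,c,d,e) \in \mathbb{F}_p^5 : ad-bc \neq 0\}$. Let $$A = \{(x,y) \in \{0,\dots,n-1\}^2 : (ax+by)^2 \equiv cx+dy+e \pmod p\}.$$ Then for any four distinct points $P_1,P_2,P_3,P_4 \in \{0,\dots,n-1\}^2$, the probability that $\{P_1,P_2,P_3,P_4\} \subset A$ is at most $C/p^4$.
   Context: $\mathbb{F}_p$ denotes the field with $p$ elements. -}

module Defs where

open import Data.Nat using (ℕ; _+_; _*_; _^_; _%_; _≡ᵇ_; NonZero)
open import Data.Bool using (Bool; true; false; _∧_; not)
open import Data.List using (List; []; _∷_; length; upTo; concatMap; filterᵇ; map)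
open import Data.Product using (_×_; _,_)

-- Elements of 𝔽_p are represented by their canonical residues 0,…,p-1 ∈ ℕ;
-- congruences mod p are tested by comparing remainders.

Point : Set
Point = ℕ × ℕ

Tuple : Set
Tuple = ℕ × ℕ × ℕ × ℕ × ℕ

allTuples : ℕ → List Tuple
allTuples p =
  concatMap (λ a → concatMap (λ b → concatMap (λ c → concatMap (λ d →
    map (λ e → (a , b , c , d , e)) (upTo p)) (upTo p)) (upTo p)) (upTo p)) (upTo p)

eqMod : (p : ℕ) → .{{NonZero p}} → ℕ → ℕ → Bool
eqMod p x y = (x % p) ≡ᵇ (y % p)

nondeg : (p : ℕ) → .{{NonZero p}} → Tuple → Bool
nondeg p (a , b , c , d , e) = not (eqMod p (a * d) (b * c))

inA : (p : ℕ) → .{{NonZero p}} → Tuple → Point → Bool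
inA p (a , b , c , d , e) (x , y) =
  eqMod p ((a * x + b * y) ^ 2) (c * x + d * y + e)

totalCount : (p : ℕ) → .{{NonZero p}} → ℕ
totalCount p = length (filterᵇ (nondeg p) (allTuples p))

goodCount : (p : ℕ) → .{{NonZero p}} → Point → Point → Point → Point → ℕ
goodCount p P₁ P₂ P₃ P₄ =
  length (filterᵇ (λ t → nondeg p t ∧ inA p t P₁ ∧ inA p t P₂ ∧ inA p t P₃ ∧ inA p t P₄)
                  (allTuples p))

-- Write D = a d - b c.  When D ≢ 0 the coordinates u = a x + b y, v = c x + d y determine (x, y)
-- modulo p, and in them the curve (a x + b y)² ≡ c x + d y + e is the parabola v ≡ u² - e; so its
-- points have pairwise distinct u.  Two consequences bound the number of good tuples by 2p:
--   * (a, b) determines (c, d, e): two such curves differ by an affine form vanishing at three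
--     points of a parabola, i.e. by a quadratic in u with three roots;
--   * fixing one good tuple t₀ and rewriting any other good tuple in the coordinates of t₀, its
--     equation becomes a quartic in u vanishing at the four given points.  Its two top coefficients
--     are β² and 2αβ, where D₀ (a x + b y) = α u + β v, so comparing them with the sum S of the roots
--     gives β (2α + β S) ≡ 0: the pair (a, b) lies on one of two lines through the origin.
-- Since at most 2p⁴ of the p⁵ tuples have D ≡ 0, the probability is at most 2p / (p⁵ - 2p⁴) ≤ 4 / p⁴.

module Submission where

open import Data.Bool.Base using (Bool; true; false; T; not; _∧_)
open import Data.Bool.Properties using (T-∧; T-not-≡; not-involutive)
open import Data.Integer.Base as Int using (ℤ; +_; ∣_∣)
open import Data.Integer.Properties
  using (abs-*; pos-+; pos-*; +-injective; i-j≡0⇒i≡j; ∣i∣≡0⇒i≡0; m-n≡m⊖n; ∣m⊝n∣≤m⊔n)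
open import Data.Integer.Divisibility.Signed
  using (_∣_; _∣?_; divides; ∣ᵤ⇒∣; ∣⇒∣ᵤ; ∣m∣n⇒∣m+n; ∣m∣n⇒∣m-n; ∣n⇒∣m*n)
open import Data.Integer.Tactic.RingSolver using (solve-∀)
open import Data.List.Base
  using (List; _∷_; []; map; length; _++_; concatMap; cartesianProduct; filterᵇ; upTo)
open import Data.List.Properties
  using (length-++; length-map; length-++-sucʳ; length-upTo; map-∘; map-++; map-id; concatMap-cong)
open import Data.List.Membership.Propositional using (_∈_)
open import Data.List.Membership.Propositional.Properties
  using ( ∈-∃++; ∈-++⁻; ∈-++⁺ˡ; ∈-++⁺ʳ; ∈-filter⁻; ∈-upTo⁺; ∈-upTo⁻
        ; ∈-cartesianProduct⁺; ∈-cartesianProduct⁻)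
open import Data.List.Relation.Unary.All as All using (All; _∷_; [])
import Data.List.Relation.Unary.All.Properties as Allₚ
open import Data.List.Relation.Unary.AllPairs using (AllPairs; _∷_; [])
import Data.List.Relation.Unary.AllPairs.Properties as AllPairsₚ
open import Data.List.Relation.Unary.Any using (here; there)
open import Data.List.Relation.Unary.Unique.Propositional using (Unique)
import Data.List.Relation.Unary.Unique.Propositional.Properties as Uniqueₚ
open import Data.Nat.Base as Nat using (ℕ; zero; suc; _≤_; _<_; z≤n; s≤s; NonZero)
open import Data.Nat.Divisibility using (>⇒∤) renaming (_∣_ to _∣ℕ_)
open import Data.Nat.DivMod using (m≡m%n+[m/n]*n; m%n<n)
open import Data.Nat.Primality using (Prime; euclidsLemma)
open import Data.Nat.Properties
  using ( ≤-trans; ≤-reflexive; ≤-<-trans; <-trans; <⇒≤; ⊔-lub; +-suc; +-identityʳ; *-identityʳ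
        ; *-monoˡ-≤; *-monoʳ-≤; +-monoʳ-≤; +-cancelʳ-≤; *-distribˡ-+; m≤n*m; ≡ᵇ⇒≡; ≡⇒≡ᵇ
        ; module ≤-Reasoning)
import Data.Nat.Tactic.RingSolver as ℕ-Solver
open import Data.Product.Base using (_×_; _,_; ∃-syntax; proj₁; proj₂)
open import Data.Sum.Base using (_⊎_; inj₁; inj₂; [_,_]′)
open import Function.Base using (_∘_; id; _on_)
open import Function.Bundles using (Equivalence)
open import Relation.Nullary.Decidable using (Dec; yes; no; does; T?)
open import Relation.Nullary.Negation using (¬_; contradiction)
open import Relation.Binary.PropositionalEquality
  using (_≡_; _≢_; refl; sym; trans; cong; cong₂; subst; subst₂; module ≡-Reasoning)

open import Defs

module _ {A B : Set} where

  length-cartesianProduct : ∀ (xs : List A) (ys : List B) →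
                            length (cartesianProduct xs ys) ≡ length xs Nat.* length ys
  length-cartesianProduct []       ys = refl
  length-cartesianProduct (x ∷ xs) ys = trans (length-++ (map (x ,_) ys))
    (cong₂ Nat._+_ (length-map (x ,_) ys) (length-cartesianProduct xs ys))

  concatMap≡map-cartesianProduct : ∀ {C : Set} (f : A × B → C) xs ys →
    concatMap (λ x → map (λ y → f (x , y)) ys) xs ≡ map f (cartesianProduct xs ys)
  concatMap≡map-cartesianProduct f []       ys = refl
  concatMap≡map-cartesianProduct f (x ∷ xs) ys = trans
    (cong₂ _++_ (map-∘ ys) (concatMap≡map-cartesianProduct f xs ys))
    (sym (map-++ f (map (x ,_) ys) (cartesianProduct xs ys)))

  ∈-remove : ∀ ys₁ {ys₂ : List B} {v w} → v ∈ ys₁ ++ w ∷ ys₂ → v ≢ w → v ∈ ys₁ ++ ys₂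
  ∈-remove ys₁ v∈ v≢w with ∈-++⁻ ys₁ v∈
  ... | inj₁ v∈ys₁         = ∈-++⁺ˡ v∈ys₁
  ... | inj₂ (here v≡w)    = contradiction v≡w v≢w
  ... | inj₂ (there v∈ys₂) = ∈-++⁺ʳ ys₁ v∈ys₂

  length-≤-injection : ∀ {xs : List A} {ys : List B} (f : A → B) → Unique xs →
                       (∀ {x y} → x ∈ xs → y ∈ xs → f x ≡ f y → x ≡ y) →
                       (∀ {x} → x ∈ xs → f x ∈ ys) → length xs ≤ length ys
  length-≤-injection {[]}     f _               _         _    = z≤n
  length-≤-injection {x ∷ xs} f (x∉xs ∷ unique) injective f∈ys
    with ys₁ , ys₂ , refl ← ∈-∃++ (f∈ys (here refl)) =
    ≤-trans (s≤s (length-≤-injection f unique (λ u v → injective (there u) (there v)) f∈ys₁++ys₂))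
            (≤-reflexive (sym (length-++-sucʳ ys₁ (f x) ys₂)))
    where
    f∈ys₁++ys₂ : ∀ {z} → z ∈ xs → f z ∈ ys₁ ++ ys₂
    f∈ys₁++ys₂ z∈xs = ∈-remove ys₁ (f∈ys (there z∈xs))
      (λ fz≡fx → All.lookup x∉xs z∈xs (injective (here refl) (there z∈xs) (sym fz≡fx)))

module _ {A : Set} where

  length-≤-if-inhabited : ∀ (xs : List A) {n} → (∀ {x} → x ∈ xs → length xs ≤ n) → length xs ≤ n
  length-≤-if-inhabited []       _     = z≤n
  length-≤-if-inhabited (x ∷ xs) bound = bound (here refl)

  length-filterᵇ-partition : ∀ (P : A → Bool) xs →
    length (filterᵇ P xs) Nat.+ length (filterᵇ (not ∘ P) xs) ≡ length xs
  length-filterᵇ-partition P []       = refl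
  length-filterᵇ-partition P (x ∷ xs) with P x
  ... | true  = cong suc (length-filterᵇ-partition P xs)
  ... | false = trans (+-suc _ _) (cong suc (length-filterᵇ-partition P xs))

  AllPairs-map-All : ∀ {P : A → Set} {R S : A → A → Set} →
                     (∀ {x y} → P x → P y → R x y → S x y) →
                     ∀ {xs} → All P xs → AllPairs R xs → AllPairs S xs
  AllPairs-map-All f []         []         = []
  AllPairs-map-All f (px ∷ pxs) (rx ∷ rxs) =
    All.zipWith (λ (py , rxy) → f px py rxy) (pxs , rx) ∷ AllPairs-map-All f pxs rxs

booleans : List Bool
booleans = true ∷ false ∷ []

∈-booleans : ∀ s → s ∈ booleans
∈-booleans true  = here refl
∈-booleans false = there (here refl)

T-not⇒¬T : ∀ {b} → T (not b) → ¬ T b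
T-not⇒¬T nb = subst T (Equivalence.to T-not-≡ nb)

select : ∀ (F : Bool → Set) (F? : Dec (F true)) → F true ⊎ F false → F (does F?)
select F (yes f) _        = f
select F (no ¬f) (inj₁ f) = contradiction f ¬f
select F (no _)  (inj₂ g) = g

module Modular {p : ℕ} (p-prime : Prime p) where

  open Int using (_+_; _*_; _-_; -_)

  infix 4 _≡0 _≢0 _≈_ _≉_

  _≡0 : ℤ → Set
  x ≡0 = + p ∣ x

  _≢0 : ℤ → Set
  x ≢0 = ¬ x ≡0

  _≈_ : ℤ → ℤ → Set
  x ≈ y = x - y ≡0

  _≉_ : ℤ → ℤ → Set
  x ≉ y = ¬ x ≈ y

  _≡0? : ∀ x → Dec (x ≡0)
  x ≡0? = + p ∣? x

  ≡0-resp : ∀ {x y} → x ≡ y → x ≡0 → y ≡0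
  ≡0-resp = subst _≡0

  ≡0-linear₂ : ∀ {x y z} c d → x ≡0 → y ≡0 → z ≡ c * x + d * y → z ≡0
  ≡0-linear₂ c d x≡0 y≡0 z≡ =
    ≡0-resp (sym z≡) (∣m∣n⇒∣m+n (∣n⇒∣m*n c x≡0) (∣n⇒∣m*n d y≡0))

  ≡0-linear₃ : ∀ {x y w z} c d f → x ≡0 → y ≡0 → w ≡0 → z ≡ c * x + d * y + f * w → z ≡0
  ≡0-linear₃ c d f x≡0 y≡0 w≡0 z≡ =
    ≡0-resp (sym z≡) (∣m∣n⇒∣m+n (∣m∣n⇒∣m+n (∣n⇒∣m*n c x≡0) (∣n⇒∣m*n d y≡0)) (∣n⇒∣m*n f w≡0))

  ≡0-product : ∀ x y → x * y ≡0 → x ≡0 ⊎ y ≡0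
  ≡0-product x y xy≡0
    with euclidsLemma ∣ x ∣ ∣ y ∣ p-prime (subst (p ∣ℕ_) (abs-* x y) (∣⇒∣ᵤ xy≡0))
  ... | inj₁ p∣x = inj₁ (∣ᵤ⇒∣ p∣x)
  ... | inj₂ p∣y = inj₂ (∣ᵤ⇒∣ p∣y)

  ≡0-cancelˡ : ∀ {x y} → x ≢0 → x * y ≡0 → y ≡0
  ≡0-cancelˡ {x} {y} x≢0 xy≡0 with ≡0-product x y xy≡0
  ... | inj₁ x≡0 = contradiction x≡0 x≢0
  ... | inj₂ y≡0 = y≡0

  ≈-cancelˡ : ∀ {a d d′ x} → a ≢0 → a * d ≈ x → a * d′ ≈ x → d ≈ d′
  ≈-cancelˡ {a} {d} {d′} {x} a≢0 ad≈x ad′≈x =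
    ≡0-cancelˡ a≢0 (≡0-linear₂ (+ 1) (- + 1) ad≈x ad′≈x (identity a d d′ x))
    where
    identity : ∀ a d d′ x → a * (d - d′) ≡ + 1 * (a * d - x) + - + 1 * (a * d′ - x)
    identity = solve-∀

  ≡0-quotient : ∀ {δ x y q} → δ ≢0 → x ≡0 → y ≡0 → x - y ≡ δ * q → q ≡0
  ≡0-quotient δ≢0 x≡0 y≡0 eq = ≡0-cancelˡ δ≢0 (≡0-resp eq (∣m∣n⇒∣m-n x≡0 y≡0))

  quadratic-three-roots : ∀ {A B C r₁ r₂ r₃ rs} → AllPairs _≉_ (r₁ ∷ r₂ ∷ r₃ ∷ rs) →
                          All (λ r → A * r * r + B * r + C ≡0) (r₁ ∷ r₂ ∷ r₃ ∷ rs) →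
                          A ≡0 × B ≡0 × C ≡0
  quadratic-three-roots {A} {B} {C} {r₁} {r₂} {r₃}
    ((r₁≉r₂ ∷ r₁≉r₃ ∷ _) ∷ (r₂≉r₃ ∷ _) ∷ _) (f₁ ∷ f₂ ∷ f₃ ∷ _) = A≡0 , B≡0 , C≡0
    where
    first-difference : ∀ A B C r s →
      (A * r * r + B * r + C) - (A * s * s + B * s + C) ≡ (r - s) * (A * (r + s) + B)
    first-difference = solve-∀
    second-difference : ∀ A B r s t → (A * (r + s) + B) - (A * (r + t) + B) ≡ (s - t) * A
    second-difference = solve-∀
    B-from-slope : ∀ A B r s → B ≡ + 1 * (A * (r + s) + B) + - (r + s) * A
    B-from-slope = solve-∀
    C-from-value : ∀ A B C r → C ≡ + 1 * (A * r * r + B * r + C) + - (r * r) * A + - r * B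
    C-from-value = solve-∀
    slope₁₂ : A * (r₁ + r₂) + B ≡0
    slope₁₂ = ≡0-quotient r₁≉r₂ f₁ f₂ (first-difference A B C r₁ r₂)
    slope₁₃ : A * (r₁ + r₃) + B ≡0
    slope₁₃ = ≡0-quotient r₁≉r₃ f₁ f₃ (first-difference A B C r₁ r₃)
    A≡0 : A ≡0
    A≡0 = ≡0-quotient r₂≉r₃ slope₁₂ slope₁₃ (second-difference A B r₁ r₂ r₃)
    B≡0 : B ≡0
    B≡0 = ≡0-linear₂ (+ 1) (- (r₁ + r₂)) slope₁₂ A≡0 (B-from-slope A B r₁ r₂)
    C≡0 : C ≡0
    C≡0 = ≡0-linear₃ (+ 1) (- (r₁ * r₁)) (- r₁) f₁ A≡0 B≡0 (C-from-value A B C r₁)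

  quartic-four-roots : ∀ {c₄ c₃ c₂ c₁ c₀ r₁ r₂ r₃ r₄} → AllPairs _≉_ (r₁ ∷ r₂ ∷ r₃ ∷ r₄ ∷ []) →
    All (λ r → c₄ * r * r * r * r + c₃ * r * r * r + c₂ * r * r + c₁ * r + c₀ ≡0)
        (r₁ ∷ r₂ ∷ r₃ ∷ r₄ ∷ []) →
    c₃ + c₄ * (r₁ + r₂ + r₃ + r₄) ≡0
  quartic-four-roots {c₄} {c₃} {c₂} {c₁} {c₀} {r₁} {r₂} {r₃} {r₄}
    ((r₁≉r₂ ∷ r₁≉r₃ ∷ r₁≉r₄ ∷ []) ∷ (r₂≉r₃ ∷ r₂≉r₄ ∷ []) ∷ (r₃≉r₄ ∷ []) ∷ [] ∷ [])
    (f₁ ∷ f₂ ∷ f₃ ∷ f₄ ∷ []) =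
    ≡0-quotient r₃≉r₄ Δ₁₂₃ Δ₁₂₄ (third-difference c₄ c₃ c₂ r₁ r₂ r₃ r₄)
    where
    Δ : ℤ → ℤ → ℤ
    Δ r s = c₄ * (r * r * r + r * r * s + r * s * s + s * s * s)
            + c₃ * (r * r + r * s + s * s) + c₂ * (r + s) + c₁
    Δ² : ℤ → ℤ → ℤ → ℤ
    Δ² r s t = c₄ * (r * r + s * s + t * t + r * s + r * t + s * t) + c₃ * (r + s + t) + c₂
    first-difference : ∀ c₄ c₃ c₂ c₁ c₀ r s →
      let f = λ x → c₄ * x * x * x * x + c₃ * x * x * x + c₂ * x * x + c₁ * x + c₀ in
      f r - f s ≡ (r - s) * (c₄ * (r * r * r + r * r * s + r * s * s + s * s * s)
                             + c₃ * (r * r + r * s + s * s) + c₂ * (r + s) + c₁)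
    first-difference = solve-∀
    second-difference : ∀ c₄ c₃ c₂ c₁ r s t →
      let Δ = λ x y → c₄ * (x * x * x + x * x * y + x * y * y + y * y * y)
                      + c₃ * (x * x + x * y + y * y) + c₂ * (x + y) + c₁ in
      Δ r s - Δ r t ≡ (s - t) * (c₄ * (r * r + s * s + t * t + r * s + r * t + s * t)
                                 + c₃ * (r + s + t) + c₂)
    second-difference = solve-∀
    third-difference : ∀ c₄ c₃ c₂ r s t w →
      let Δ² = λ x y z → c₄ * (x * x + y * y + z * z + x * y + x * z + y * z) + c₃ * (x + y + z) + c₂ in
      Δ² r s t - Δ² r s w ≡ (t - w) * (c₃ + c₄ * (r + s + t + w))
    third-difference = solve-∀
    Δ₁₂ : Δ r₁ r₂ ≡0
    Δ₁₂ = ≡0-quotient r₁≉r₂ f₁ f₂ (first-difference c₄ c₃ c₂ c₁ c₀ r₁ r₂)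
    Δ₁₃ : Δ r₁ r₃ ≡0
    Δ₁₃ = ≡0-quotient r₁≉r₃ f₁ f₃ (first-difference c₄ c₃ c₂ c₁ c₀ r₁ r₃)
    Δ₁₄ : Δ r₁ r₄ ≡0
    Δ₁₄ = ≡0-quotient r₁≉r₄ f₁ f₄ (first-difference c₄ c₃ c₂ c₁ c₀ r₁ r₄)
    Δ₁₂₃ : Δ² r₁ r₂ r₃ ≡0
    Δ₁₂₃ = ≡0-quotient r₂≉r₃ Δ₁₂ Δ₁₃ (second-difference c₄ c₃ c₂ c₁ r₁ r₂ r₃)
    Δ₁₂₄ : Δ² r₁ r₂ r₄ ≡0
    Δ₁₂₄ = ≡0-quotient r₂≉r₄ Δ₁₂ Δ₁₄ (second-difference c₄ c₃ c₂ c₁ r₁ r₂ r₄)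

  Coefficients : Set
  Coefficients = ℤ × ℤ × ℤ × ℤ × ℤ

  det : Coefficients → ℤ
  det (a , b , c , d , _) = a * d - b * c

  u-coord : Coefficients → ℤ × ℤ → ℤ
  u-coord (a , b , _) (x , y) = a * x + b * y

  OnCurve : Coefficients → ℤ × ℤ → Set
  OnCurve (a , b , c , d , e) (x , y) = (a * x + b * y) * (a * x + b * y) ≈ c * x + d * y + e

  u-coord-injective : ∀ {t x y x′ y′} → det t ≢0 → OnCurve t (x , y) → OnCurve t (x′ , y′) →
                      u-coord t (x , y) ≈ u-coord t (x′ , y′) → x ≈ x′ × y ≈ y′
  u-coord-injective {a , b , c , d , e} {x} {y} {x′} {y′} D≢0 h h′ Δu≡0 =
    ≡0-cancelˡ D≢0 (≡0-linear₂ d (- b) Δu≡0 Δv≡0 (x-identity a b c d x y x′ y′)) ,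
    ≡0-cancelˡ D≢0 (≡0-linear₂ (- c) a Δu≡0 Δv≡0 (y-identity a b c d x y x′ y′))
    where
    v-identity : ∀ a b c d e x y x′ y′ → let W = a * x + b * y ; W′ = a * x′ + b * y′ in
      (c * x + d * y) - (c * x′ + d * y′)
        ≡ - + 1 * (W * W - (c * x + d * y + e)) + + 1 * (W′ * W′ - (c * x′ + d * y′ + e))
          + (W + W′) * (W - W′)
    v-identity = solve-∀
    x-identity : ∀ a b c d x y x′ y′ →
      (a * d - b * c) * (x - x′)
        ≡ d * ((a * x + b * y) - (a * x′ + b * y′)) + - b * ((c * x + d * y) - (c * x′ + d * y′))
    x-identity = solve-∀
    y-identity : ∀ a b c d x y x′ y′ →
      (a * d - b * c) * (y - y′)
        ≡ - c * ((a * x + b * y) - (a * x′ + b * y′)) + a * ((c * x + d * y) - (c * x′ + d * y′))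
    y-identity = solve-∀
    Δv≡0 : (c * x + d * y) - (c * x′ + d * y′) ≡0
    Δv≡0 = ≡0-linear₃ (- + 1) (+ 1) ((a * x + b * y) + (a * x′ + b * y′)) h h′ Δu≡0
                       (v-identity a b c d e x y x′ y′)

  same-ab⇒same-cde : ∀ {a b c d e c′ d′ e′ P₁ P₂ P₃ Ps} →
    let t = (a , b , c , d , e) ; Qs = P₁ ∷ P₂ ∷ P₃ ∷ Ps in
    det t ≢0 → AllPairs (_≉_ on u-coord t) Qs →
    All (OnCurve t) Qs → All (OnCurve (a , b , c′ , d′ , e′)) Qs →
    c ≈ c′ × d ≈ d′ × e ≈ e′
  same-ab⇒same-cde {a} {b} {c} {d} {e} {c′} {d′} {e′} {P₁} {P₂} {P₃} {Ps} D≢0 distinct h h′ =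
    conclude (quadratic-three-roots (AllPairsₚ.map⁺ distinct) roots)
    where
    t = (a , b , c , d , e)
    D = a * d - b * c
    A = (d - d′) * a - (c - c′) * b
    B = (c - c′) * d - (d - d′) * c
    C = D * (e - e′) - A * e
    -- D times the difference of the two equations, with v eliminated using the first one.
    root-identity : ∀ a b c d e c′ d′ e′ x y →
      let D = a * d - b * c ; A = (d - d′) * a - (c - c′) * b ; B = (c - c′) * d - (d - d′) * c
          C = D * (e - e′) - A * e ; u = a * x + b * y in
      A * u * u + B * u + C
        ≡ D * (u * u - (c′ * x + d′ * y + e′)) + (A - D) * (u * u - (c * x + d * y + e))
    root-identity = solve-∀
    c-identity : ∀ a b c d c′ d′ →
      (a * d - b * c) * (c - c′)
        ≡ a * ((c - c′) * d - (d - d′) * c) + c * ((d - d′) * a - (c - c′) * b)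
    c-identity = solve-∀
    d-identity : ∀ a b c d c′ d′ →
      (a * d - b * c) * (d - d′)
        ≡ b * ((c - c′) * d - (d - d′) * c) + d * ((d - d′) * a - (c - c′) * b)
    d-identity = solve-∀
    e-identity : ∀ a b c d e c′ d′ e′ → let D = a * d - b * c ; A = (d - d′) * a - (c - c′) * b in
      D * (e - e′) ≡ + 1 * (D * (e - e′) - A * e) + e * A
    e-identity = solve-∀
    root : ∀ {P} → OnCurve t P × OnCurve (a , b , c′ , d′ , e′) P →
           A * u-coord t P * u-coord t P + B * u-coord t P + C ≡0
    root {x , y} (h , h′) = ≡0-linear₂ D (A - D) h′ h (root-identity a b c d e c′ d′ e′ x y)
    roots : All (λ r → A * r * r + B * r + C ≡0) (map (u-coord t) (P₁ ∷ P₂ ∷ P₃ ∷ Ps))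
    roots = Allₚ.map⁺ (All.zipWith root (h , h′))
    conclude : A ≡0 × B ≡0 × C ≡0 → c ≈ c′ × d ≈ d′ × e ≈ e′
    conclude (A≡0 , B≡0 , C≡0) =
      ≡0-cancelˡ D≢0 (≡0-linear₂ a c B≡0 A≡0 (c-identity a b c d c′ d′)) ,
      ≡0-cancelˡ D≢0 (≡0-linear₂ b d B≡0 A≡0 (d-identity a b c d c′ d′)) ,
      ≡0-cancelˡ D≢0 (≡0-linear₂ (+ 1) e C≡0 A≡0 (e-identity a b c d e c′ d′ e′))

  OnLine : ℤ × ℤ → ℤ × ℤ → Set
  OnLine (k , m) (a , b) = k * a + m * b ≡0

  OnLine? : ∀ ℓ P → Dec (OnLine ℓ P)
  OnLine? (k , m) (a , b) = (k * a + m * b) ≡0?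

  Nontrivial : ℤ × ℤ → Set
  Nontrivial (k , m) = ¬ (k ≡0 × m ≡0)

  OnLine-a-determined : ∀ {k m a a′ b} → k ≢0 →
                        OnLine (k , m) (a , b) → OnLine (k , m) (a′ , b) → a ≈ a′
  OnLine-a-determined {k} {m} {a} {a′} {b} k≢0 ℓ ℓ′ =
    ≡0-cancelˡ k≢0 (≡0-linear₂ (+ 1) (- + 1) ℓ ℓ′ (identity k m a a′ b))
    where
    identity : ∀ k m a a′ b → k * (a - a′) ≡ + 1 * (k * a + m * b) + - + 1 * (k * a′ + m * b)
    identity = solve-∀

  OnLine-b-determined : ∀ {k m a b b′} → m ≢0 →
                        OnLine (k , m) (a , b) → OnLine (k , m) (a , b′) → b ≈ b′
  OnLine-b-determined {k} {m} {a} {b} {b′} m≢0 ℓ ℓ′ =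
    ≡0-cancelˡ m≢0 (≡0-linear₂ (+ 1) (- + 1) ℓ ℓ′ (identity k m a b b′))
    where
    identity : ∀ k m a b b′ → m * (b - b′) ≡ + 1 * (k * a + m * b) + - + 1 * (k * a + m * b′)
    identity = solve-∀

  -- The lines β ≡ 0 and 2α + β S ≡ 0 in the (a, b)-plane, where α = a d₀ - b c₀ and
  -- β = b a₀ - a b₀ satisfy D₀ (a x + b y) = α u + β v in the coordinates u, v of t₀.
  reference-line : Coefficients → ℤ → Bool → ℤ × ℤ
  reference-line (a₀ , b₀ , c₀ , d₀ , _) S true  = - b₀ , a₀
  reference-line (a₀ , b₀ , c₀ , d₀ , _) S false = + 2 * d₀ - S * b₀ , S * a₀ - + 2 * c₀

  reference-line-nontrivial : ∀ {t₀} → + 2 ≢0 → det t₀ ≢0 → ∀ S s → Nontrivial (reference-line t₀ S s)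
  reference-line-nontrivial {a₀ , b₀ , c₀ , d₀ , _} 2≢0 D≢0 S true (-b₀≡0 , a₀≡0) =
    D≢0 (≡0-linear₂ d₀ c₀ a₀≡0 -b₀≡0 (identity a₀ b₀ c₀ d₀))
    where
    identity : ∀ a₀ b₀ c₀ d₀ → a₀ * d₀ - b₀ * c₀ ≡ d₀ * a₀ + c₀ * - b₀
    identity = solve-∀
  reference-line-nontrivial {a₀ , b₀ , c₀ , d₀ , _} 2≢0 D≢0 S false (k≡0 , m≡0) =
    [ 2≢0 , D≢0 ]′ (≡0-product (+ 2) (a₀ * d₀ - b₀ * c₀)
                     (≡0-linear₂ a₀ b₀ k≡0 m≡0 (identity a₀ b₀ c₀ d₀ S)))
    where
    identity : ∀ a₀ b₀ c₀ d₀ S →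
      + 2 * (a₀ * d₀ - b₀ * c₀) ≡ a₀ * (+ 2 * d₀ - S * b₀) + b₀ * (S * a₀ - + 2 * c₀)
    identity = solve-∀

  four-points⇒on-line : ∀ {a₀ b₀ c₀ d₀ e₀ a b c d e P₁ P₂ P₃ P₄} →
    let t₀ = (a₀ , b₀ , c₀ , d₀ , e₀) ; Qs = P₁ ∷ P₂ ∷ P₃ ∷ P₄ ∷ []
        S = u-coord t₀ P₁ + u-coord t₀ P₂ + u-coord t₀ P₃ + u-coord t₀ P₄ in
    AllPairs (_≉_ on u-coord t₀) Qs → All (OnCurve t₀) Qs → All (OnCurve (a , b , c , d , e)) Qs →
    OnLine (reference-line t₀ S true) (a , b) ⊎ OnLine (reference-line t₀ S false) (a , b)
  four-points⇒on-line {a₀} {b₀} {c₀} {d₀} {e₀} {a} {b} {c} {d} {e} {P₁} {P₂} {P₃} {P₄} distinct h₀ h =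
    ≡0-product (- b₀ * a + a₀ * b) ((+ 2 * d₀ - S * b₀) * a + (S * a₀ - + 2 * c₀) * b)
      (≡0-resp (factorisation a b a₀ b₀ c₀ d₀ S) q₃+q₄S≡0)
    where
    t₀ = (a₀ , b₀ , c₀ , d₀ , e₀)
    S = u-coord t₀ P₁ + u-coord t₀ P₂ + u-coord t₀ P₃ + u-coord t₀ P₄
    D = a₀ * d₀ - b₀ * c₀
    α = a * d₀ - b * c₀
    β = b * a₀ - a * b₀
    γ = c * d₀ - d * c₀
    δ = d * a₀ - c * b₀
    q₄ = β * β
    q₃ = + 2 * α * β
    q₂ = α * α - + 2 * β * β * e₀ - D * δ
    q₁ = - (+ 2 * α * β * e₀) - D * γ
    q₀ = β * β * e₀ * e₀ + D * δ * e₀ - D * D * e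
    -- D² times the equation of t, with v replaced by u² - e₀ using the equation of t₀.
    quartic-identity : ∀ a b c d e a₀ b₀ c₀ d₀ e₀ x y →
      let u = a₀ * x + b₀ * y ; v = c₀ * x + d₀ * y ; D = a₀ * d₀ - b₀ * c₀
          α = a * d₀ - b * c₀ ; β = b * a₀ - a * b₀ ; γ = c * d₀ - d * c₀ ; δ = d * a₀ - c * b₀ in
      β * β * u * u * u * u + + 2 * α * β * u * u * u + (α * α - + 2 * β * β * e₀ - D * δ) * u * u
        + (- (+ 2 * α * β * e₀) - D * γ) * u + (β * β * e₀ * e₀ + D * δ * e₀ - D * D * e)
      ≡ D * D * ((a * x + b * y) * (a * x + b * y) - (c * x + d * y + e))
        + (β * (+ 2 * α * u + β * (v + u * u - e₀)) - D * δ) * (u * u - (c₀ * x + d₀ * y + e₀))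
    quartic-identity = solve-∀
    factorisation : ∀ a b a₀ b₀ c₀ d₀ S → let α = a * d₀ - b * c₀ ; β = b * a₀ - a * b₀ in
      + 2 * α * β + β * β * S
        ≡ (- b₀ * a + a₀ * b) * ((+ 2 * d₀ - S * b₀) * a + (S * a₀ - + 2 * c₀) * b)
    factorisation = solve-∀
    root : ∀ {P} → OnCurve t₀ P × OnCurve (a , b , c , d , e) P →
           let u = u-coord t₀ P in q₄ * u * u * u * u + q₃ * u * u * u + q₂ * u * u + q₁ * u + q₀ ≡0
    root {x , y} (h₀ , h) = ≡0-linear₂ (D * D) K h h₀ (quartic-identity a b c d e a₀ b₀ c₀ d₀ e₀ x y)
      where
      u = a₀ * x + b₀ * y
      K = β * (+ 2 * α * u + β * (c₀ * x + d₀ * y + u * u - e₀)) - D * δ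
    roots : All (λ r → q₄ * r * r * r * r + q₃ * r * r * r + q₂ * r * r + q₁ * r + q₀ ≡0)
                (map (u-coord t₀) (P₁ ∷ P₂ ∷ P₃ ∷ P₄ ∷ []))
    roots = Allₚ.map⁺ (All.zipWith root (h₀ , h))
    q₃+q₄S≡0 : q₃ + q₄ * S ≡0
    q₃+q₄S≡0 = quartic-four-roots {q₄} {q₃} {q₂} {q₁} {q₀} (AllPairsₚ.map⁺ distinct) roots

module Residues {p : ℕ} .{{_ : NonZero p}} (p-prime : Prime p) where

  open Modular p-prime
  open Nat using (_+_; _*_; _^_; _%_; _/_)

  ≈⇒≡ : ∀ {x y} → x < p → y < p → + x ≈ + y → x ≡ y
  ≈⇒≡ {x} {y} x<p y<p x≈y =
    +-injective (i-j≡0⇒i≡j (+ x) (+ y) (∣i∣≡0⇒i≡0 (multiple-below-p (∣⇒∣ᵤ x≈y) bound)))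
    where
    multiple-below-p : ∀ {k} → p ∣ℕ k → k < p → k ≡ 0
    multiple-below-p {zero}  _   _   = refl
    multiple-below-p {suc k} p∣k k<p = contradiction p∣k (>⇒∤ k<p)
    bound : ∣ + x Int.- + y ∣ < p
    bound = ≤-<-trans (≤-reflexive (cong ∣_∣ (m-n≡m⊖n x y)))
                      (≤-<-trans (∣m⊝n∣≤m⊔n x y) (⊔-lub x<p y<p))

  ≡0⇒≡zero : ∀ {x} → x < p → + x ≡0 → x ≡ 0
  ≡0⇒≡zero {x} x<p x≡0 = ≈⇒≡ x<p (≤-<-trans z≤n x<p) (≡0-resp (cong +_ (sym (+-identityʳ x))) x≡0)

  residue-nonzero : ∀ {a} → suc a < p → + suc a ≢0
  residue-nonzero a<p a≡0 = contradiction (≡0⇒≡zero a<p a≡0) λ ()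

  ≈-mod : ∀ x → + x ≈ + (x % p)
  ≈-mod x = divides (+ (x / p))
    (trans (cong (Int._- + (x % p)) division) (remainder-cancels (+ (x % p)) (+ (x / p)) (+ p)))
    where
    division : + x ≡ + (x % p) Int.+ + (x / p) Int.* + p
    division = trans (cong +_ (m≡m%n+[m/n]*n x p))
                     (trans (pos-+ (x % p) _) (cong (Int._+_ (+ (x % p))) (pos-* (x / p) p)))
    remainder-cancels : ∀ r q n → (r Int.+ q Int.* n) Int.- r ≡ q Int.* n
    remainder-cancels = solve-∀

  eqMod⇒≈ : ∀ x y → T (eqMod p x y) → + x ≈ + y
  eqMod⇒≈ x y x%p≡ᵇy%p =
    ≡0-linear₂ (+ 1) (Int.- + 1) (≈-mod x) (subst (λ r → + y ≈ + r) (sym x%p≡y%p) (≈-mod y))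
               (identity (+ x) (+ y) (+ (x % p)))
    where
    x%p≡y%p : x % p ≡ y % p
    x%p≡y%p = ≡ᵇ⇒≡ _ _ x%p≡ᵇy%p
    identity : ∀ x y r → x Int.- y ≡ + 1 Int.* (x Int.- r) Int.+ Int.- + 1 Int.* (y Int.- r)
    identity = solve-∀

  ≈⇒eqMod : ∀ x y → + x ≈ + y → T (eqMod p x y)
  ≈⇒eqMod x y x≈y = ≡⇒≡ᵇ _ _ (≈⇒≡ (m%n<n x p) (m%n<n y p)
    (≡0-linear₃ (Int.- + 1) (+ 1) (+ 1) (≈-mod x) x≈y (≈-mod y)
                (identity (+ x) (+ y) (+ (x % p)) (+ (y % p)))))
    where
    identity : ∀ x y r s → r Int.- s
                 ≡ Int.- + 1 Int.* (x Int.- r) Int.+ + 1 Int.* (x Int.- y) Int.+ + 1 Int.* (y Int.- s)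
    identity = solve-∀

  ⌜_⌝ : Tuple → Coefficients
  ⌜ a , b , c , d , e ⌝ = + a , + b , + c , + d , + e

  ⌜_⌝ₚ : Point → ℤ × ℤ
  ⌜ x , y ⌝ₚ = + x , + y

  pos-linear : ∀ a x b y → + (a * x + b * y) ≡ + a Int.* + x Int.+ + b Int.* + y
  pos-linear a x b y = trans (pos-+ (a * x) (b * y)) (cong₂ Int._+_ (pos-* a x) (pos-* b y))

  inA⇒OnCurve : ∀ t P → T (inA p t P) → OnCurve ⌜ t ⌝ ⌜ P ⌝ₚ
  inA⇒OnCurve (a , b , c , d , e) (x , y) P∈A = subst₂ _≈_ square affine (eqMod⇒≈ _ _ P∈A)
    where
    square : + ((a * x + b * y) ^ 2)
               ≡ (+ a Int.* + x Int.+ + b Int.* + y) Int.* (+ a Int.* + x Int.+ + b Int.* + y)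
    square = trans (pos-* (a * x + b * y) _)
      (cong₂ Int._*_ (pos-linear a x b y) (trans (cong +_ (*-identityʳ _)) (pos-linear a x b y)))
    affine : + (c * x + d * y + e) ≡ + c Int.* + x Int.+ + d Int.* + y Int.+ + e
    affine = trans (pos-+ (c * x + d * y) e) (cong (Int._+ + e) (pos-linear c x d y))

  nondeg⇒det≢0 : ∀ t → T (nondeg p t) → det ⌜ t ⌝ ≢0
  nondeg⇒det≢0 (a , b , c , d , e) nd ad≈bc =
    T-not⇒¬T nd (≈⇒eqMod _ _ (subst₂ _≈_ (sym (pos-* a d)) (sym (pos-* b c)) ad≈bc))

  degenerate⇒det≡0 : ∀ t → T (not (nondeg p t)) → det ⌜ t ⌝ ≡0
  degenerate⇒det≡0 (a , b , c , d , e) deg =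
    subst₂ _≈_ (pos-* a d) (pos-* b c) (eqMod⇒≈ _ _ (subst T (not-involutive _) deg))

  -- A point of a nontrivial line k a + m b ≡ 0 is determined by its a-coordinate,
  -- unless m ≡ 0, in which case a is fixed and b is free.
  line-coordinate : ℤ × ℤ → ℕ × ℕ → ℕ
  line-coordinate (_ , m) = choose (m ≡0?)
    where
    choose : ∀ {A : Set} → Dec A → ℕ × ℕ → ℕ
    choose (yes _) (a , b) = b
    choose (no _)  (a , b) = a

  line-coordinate-below : ∀ ℓ {a b} → a < p → b < p → line-coordinate ℓ (a , b) < p
  line-coordinate-below (_ , m) a<p b<p with m ≡0?
  ... | yes _ = b<p
  ... | no _  = a<p

  line-coordinate-injective : ∀ {ℓ a b a′ b′} → Nontrivial ℓ → a < p → b < p → a′ < p → b′ < p →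
    OnLine ℓ ⌜ a , b ⌝ₚ → OnLine ℓ ⌜ a′ , b′ ⌝ₚ →
    line-coordinate ℓ (a , b) ≡ line-coordinate ℓ (a′ , b′) → (a , b) ≡ (a′ , b′)
  line-coordinate-injective {k , m} {a} {b} {a′} {b′} nontrivial a<p b<p a′<p b′<p ℓ ℓ′ same
    with m ≡0?
  ... | yes m≡0 with refl ← same =
    cong (_, _) (≈⇒≡ a<p a′<p
      (OnLine-a-determined {k} {m} {+ a} {+ a′} (λ k≡0 → nontrivial (k≡0 , m≡0)) ℓ ℓ′))
  ... | no m≢0 with refl ← same =
    cong (_ ,_) (≈⇒≡ b<p b′<p (OnLine-b-determined {k} {m} {+ a} {+ b} m≢0 ℓ ℓ′))

module TupleCount {p : ℕ} .{{_ : NonZero p}} (p-prime : Prime p) where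

  open Modular p-prime
  open Residues p-prime
  open Nat using (_*_)

  residues : List ℕ
  residues = upTo p

  residues² : List (ℕ × ℕ)
  residues² = cartesianProduct residues residues

  residues³ : List (ℕ × ℕ × ℕ)
  residues³ = cartesianProduct residues residues²

  residues⁴ : List (ℕ × ℕ × ℕ × ℕ)
  residues⁴ = cartesianProduct residues residues³

  residues⁵ : List Tuple
  residues⁵ = cartesianProduct residues residues⁴

  allTuples≡residues⁵ : allTuples p ≡ residues⁵
  allTuples≡residues⁵ = begin
    allTuples p
      ≡⟨ concatMap-cong (λ a → concatMap-cong (λ b → concatMap-cong (λ c →
           concatMap≡map-cartesianProduct (λ t → a , b , c , t) residues residues)
           residues) residues) residues ⟩
    concatMap (λ a → concatMap (λ b → concatMap (λ c →
      map (λ t → a , b , c , t) residues²) residues) residues) residues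
      ≡⟨ concatMap-cong (λ a → concatMap-cong (λ b →
           concatMap≡map-cartesianProduct (λ t → a , b , t) residues residues²) residues) residues ⟩
    concatMap (λ a → concatMap (λ b → map (λ t → a , b , t) residues³) residues) residues
      ≡⟨ concatMap-cong (λ a → concatMap≡map-cartesianProduct (λ t → a , t) residues residues³)
                        residues ⟩
    concatMap (λ a → map (λ t → a , t) residues⁴) residues
      ≡⟨ concatMap≡map-cartesianProduct id residues residues⁴ ⟩
    map id residues⁵
      ≡⟨ map-id residues⁵ ⟩
    residues⁵ ∎
    where open ≡-Reasoning

  allTuples-unique : Unique (allTuples p)
  allTuples-unique = subst Unique (sym allTuples≡residues⁵)
    (Uniqueₚ.cartesianProduct⁺ upTo-unique (Uniqueₚ.cartesianProduct⁺ upTo-unique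
      (Uniqueₚ.cartesianProduct⁺ upTo-unique (Uniqueₚ.cartesianProduct⁺ upTo-unique upTo-unique))))
    where upTo-unique = Uniqueₚ.upTo⁺ p

  length-residues² : length residues² ≡ p * p
  length-residues² =
    trans (length-cartesianProduct residues residues) (cong₂ _*_ (length-upTo p) (length-upTo p))

  length-residues³ : length residues³ ≡ p * (p * p)
  length-residues³ =
    trans (length-cartesianProduct residues residues²) (cong₂ _*_ (length-upTo p) length-residues²)

  length-residues⁴ : length residues⁴ ≡ p * (p * (p * p))
  length-residues⁴ =
    trans (length-cartesianProduct residues residues³) (cong₂ _*_ (length-upTo p) length-residues³)

  length-allTuples : length (allTuples p) ≡ p * (p * (p * (p * p)))
  length-allTuples = trans (cong length allTuples≡residues⁵)
    (trans (length-cartesianProduct residues residues⁴) (cong₂ _*_ (length-upTo p) length-residues⁴))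

  Below : Tuple → Set
  Below (a , b , c , d , e) = a < p × b < p × c < p × d < p × e < p

  allTuples-below : ∀ {t} → t ∈ allTuples p → Below t
  allTuples-below {t} t∈ =
    let a∈ , bcde∈ = ∈-cartesianProduct⁻ residues residues⁴ (subst (t ∈_) allTuples≡residues⁵ t∈)
        b∈ , cde∈  = ∈-cartesianProduct⁻ residues residues³ bcde∈
        c∈ , de∈   = ∈-cartesianProduct⁻ residues residues² cde∈
        d∈ , e∈    = ∈-cartesianProduct⁻ residues residues de∈
    in ∈-upTo⁻ a∈ , ∈-upTo⁻ b∈ , ∈-upTo⁻ c∈ , ∈-upTo⁻ d∈ , ∈-upTo⁻ e∈

  ∈-residues⁴ : ∀ {a b c d} → a < p → b < p → c < p → d < p → (a , b , c , d) ∈ residues⁴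
  ∈-residues⁴ a<p b<p c<p d<p = ∈-cartesianProduct⁺ (∈-upTo⁺ a<p)
    (∈-cartesianProduct⁺ (∈-upTo⁺ b<p) (∈-cartesianProduct⁺ (∈-upTo⁺ c<p) (∈-upTo⁺ d<p)))

  degenerate : List Tuple
  degenerate = filterᵇ (not ∘ nondeg p) (allTuples p)

  -- Forget a when it is 0, and otherwise forget d, which a d ≡ b c then determines.
  degenerate-code : Tuple → Bool × ℕ × ℕ × ℕ × ℕ
  degenerate-code (zero  , b , c , d , e) = true  , b , c , d , e
  degenerate-code (suc a , b , c , d , e) = false , suc a , b , c , e

  degenerate-count : length degenerate ≤ 2 * (p * (p * (p * p)))
  degenerate-count = ≤-trans
    (length-≤-injection degenerate-code (Uniqueₚ.filter⁺ (T? ∘ (not ∘ nondeg p)) allTuples-unique)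
                        injective code∈)
    (≤-reflexive (trans (length-cartesianProduct booleans residues⁴) (cong (2 *_) length-residues⁴)))
    where
    member : ∀ {t} → t ∈ degenerate → Below t × det ⌜ t ⌝ ≡0
    member {t} t∈ = let t∈all , deg = ∈-filter⁻ (T? ∘ (not ∘ nondeg p)) {xs = allTuples p} t∈
                    in allTuples-below t∈all , degenerate⇒det≡0 t deg
    injective : ∀ {t t′} → t ∈ degenerate → t′ ∈ degenerate → degenerate-code t ≡ degenerate-code t′ →
                t ≡ t′
    injective {zero , _}  {zero , _}  _ _ refl = refl
    injective {suc a , b , c , d , e} {suc a , b , c , d′ , e} t∈ t′∈ refl =
      let (a<p , _ , _ , d<p , _) , ad≈bc = member t∈
          (_ , _ , _ , d′<p , _) , ad′≈bc = member t′∈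
      in cong (λ d → suc a , b , c , d , e)
              (≈⇒≡ d<p d′<p (≈-cancelˡ {d = + d} {d′ = + d′} (residue-nonzero a<p) ad≈bc ad′≈bc))
    below⇒code∈ : ∀ {t} → Below t → degenerate-code t ∈ cartesianProduct booleans residues⁴
    below⇒code∈ {zero , b , c , d , e} (_ , b<p , c<p , d<p , e<p) =
      ∈-cartesianProduct⁺ {xs = booleans} {ys = residues⁴} (∈-booleans true) (∈-residues⁴ b<p c<p d<p e<p)
    below⇒code∈ {suc a , b , c , d , e} (a<p , b<p , c<p , _ , e<p) =
      ∈-cartesianProduct⁺ {xs = booleans} {ys = residues⁴} (∈-booleans false) (∈-residues⁴ a<p b<p c<p e<p)
    code∈ : ∀ {t} → t ∈ degenerate → degenerate-code t ∈ cartesianProduct booleans residues⁴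
    code∈ t∈ = below⇒code∈ (proj₁ (member t∈))

PointBelow : ℕ → Point → Set
PointBelow p (x , y) = x < p × y < p

module GoodTuples {p : ℕ} .{{_ : NonZero p}} (p-prime : Prime p) (2<p : 2 < p)
                  (P₁ P₂ P₃ P₄ : Point)
                  (below : All (PointBelow p) (P₁ ∷ P₂ ∷ P₃ ∷ P₄ ∷ []))
                  (distinct : AllPairs _≢_ (P₁ ∷ P₂ ∷ P₃ ∷ P₄ ∷ [])) where

  open Modular p-prime
  open Residues p-prime
  open TupleCount p-prime

  good : Tuple → Bool
  good t = nondeg p t ∧ inA p t P₁ ∧ inA p t P₂ ∧ inA p t P₃ ∧ inA p t P₄

  goodTuples : List Tuple
  goodTuples = filterᵇ good (allTuples p)

  Qs : List (ℤ × ℤ)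
  Qs = map ⌜_⌝ₚ (P₁ ∷ P₂ ∷ P₃ ∷ P₄ ∷ [])

  record Good (t : Tuple) : Set where
    field
      tuple-below : Below t
      det≢0       : det ⌜ t ⌝ ≢0
      on-curve    : All (OnCurve ⌜ t ⌝) Qs

  good-member : ∀ {t} → t ∈ goodTuples → Good t
  good-member {t} t∈ =
    let t∈all , t-good = ∈-filter⁻ (T? ∘ good) {xs = allTuples p} t∈
        nd , P₁∈A , P₂∈A , P₃∈A , P₄∈A = split t-good
    in record
      { tuple-below = allTuples-below t∈all
      ; det≢0       = nondeg⇒det≢0 t nd
      ; on-curve    = inA⇒OnCurve t P₁ P₁∈A ∷ inA⇒OnCurve t P₂ P₂∈A ∷ inA⇒OnCurve t P₃ P₃∈A
                      ∷ inA⇒OnCurve t P₄ P₄∈A ∷ []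
      }
    where
    split : ∀ {v w x y z} → T (v ∧ w ∧ x ∧ y ∧ z) → T v × T w × T x × T y × T z
    split {v} {w} {x} {y} {z} vwxyz =
      let tv , twxyz = Equivalence.to (T-∧ {v}) vwxyz
          tw , txyz  = Equivalence.to (T-∧ {w}) twxyz
          tx , tyz   = Equivalence.to (T-∧ {x}) txyz
      in tv , tw , tx , Equivalence.to (T-∧ {y}) tyz

  distinct-u : ∀ {t} → Good t → AllPairs (_≉_ on u-coord ⌜ t ⌝) Qs
  distinct-u {t} g = AllPairsₚ.map⁺
    (AllPairs-map-All separated (All.zip (below , Allₚ.map⁻ (Good.on-curve g))) distinct)
    where
    separated : ∀ {P Q} → PointBelow p P × OnCurve ⌜ t ⌝ ⌜ P ⌝ₚ → PointBelow p Q × OnCurve ⌜ t ⌝ ⌜ Q ⌝ₚ →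
                P ≢ Q → u-coord ⌜ t ⌝ ⌜ P ⌝ₚ ≉ u-coord ⌜ t ⌝ ⌜ Q ⌝ₚ
    separated {x , y} {x′ , y′} ((x<p , y<p) , h) ((x′<p , y′<p) , h′) P≢Q u≈u′ =
      let x≈x′ , y≈y′ = u-coord-injective {⌜ t ⌝} (Good.det≢0 g) h h′ u≈u′
      in P≢Q (cong₂ _,_ (≈⇒≡ x<p x′<p x≈x′) (≈⇒≡ y<p y′<p y≈y′))

  same-ab⇒same-tuple : ∀ {a b c d e c′ d′ e′} → Good (a , b , c , d , e) → Good (a , b , c′ , d′ , e′) →
                       (a , b , c , d , e) ≡ (a , b , c′ , d′ , e′)
  same-ab⇒same-tuple {a} {b} {c} {d} {e} {c′} {d′} {e′} g g′ =
    let c≈c′ , d≈d′ , e≈e′ = same-ab⇒same-cde {+ a} {+ b} {+ c} {+ d} {+ e} {+ c′} {+ d′} {+ e′}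
                               (Good.det≢0 g) (distinct-u g) (Good.on-curve g) (Good.on-curve g′)
        _ , _ , c<p , d<p , e<p    = Good.tuple-below g
        _ , _ , c′<p , d′<p , e′<p = Good.tuple-below g′
    in cong (λ cde → a , b , cde)
         (cong₂ _,_ (≈⇒≡ c<p c′<p c≈c′) (cong₂ _,_ (≈⇒≡ d<p d′<p d≈d′) (≈⇒≡ e<p e′<p e≈e′)))

  module Reference {a₀ b₀ c₀ d₀ e₀ : ℕ} (g₀ : Good (a₀ , b₀ , c₀ , d₀ , e₀)) where

    t₀ : Coefficients
    t₀ = ⌜ a₀ , b₀ , c₀ , d₀ , e₀ ⌝

    S : ℤ
    S = u-coord t₀ ⌜ P₁ ⌝ₚ Int.+ u-coord t₀ ⌜ P₂ ⌝ₚ Int.+ u-coord t₀ ⌜ P₃ ⌝ₚ Int.+ u-coord t₀ ⌜ P₄ ⌝ₚ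

    line : Bool → ℤ × ℤ
    line = reference-line t₀ S

    tag : ℕ × ℕ → Bool
    tag ab = does (OnLine? (line true) ⌜ ab ⌝ₚ)

    key : Tuple → Bool × ℕ
    key (a , b , _) = tag (a , b) , line-coordinate (line (tag (a , b))) (a , b)

    on-tagged-line : ∀ {a b c d e} → Good (a , b , c , d , e) → OnLine (line (tag (a , b))) ⌜ a , b ⌝ₚ
    on-tagged-line {a} {b} {c} {d} {e} g =
      select (λ s → OnLine (line s) ⌜ a , b ⌝ₚ) (OnLine? (line true) ⌜ a , b ⌝ₚ)
        (four-points⇒on-line {+ a₀} {+ b₀} {+ c₀} {+ d₀} {+ e₀} {+ a} {+ b} {+ c} {+ d} {+ e}
          (distinct-u g₀) (Good.on-curve g₀) (Good.on-curve g))

    key⇒same-ab : ∀ {a b c d e a′ b′ c′ d′ e′} → Good (a , b , c , d , e) → Good (a′ , b′ , c′ , d′ , e′) →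
                  key (a , b , c , d , e) ≡ key (a′ , b′ , c′ , d′ , e′) → (a , b) ≡ (a′ , b′)
    key⇒same-ab {a} {b} {c} {d} {e} {a′} {b′} g g′ key≡ =
      let a<p , b<p , _   = Good.tuple-below g
          a′<p , b′<p , _ = Good.tuple-below g′
          nontrivial = reference-line-nontrivial {t₀} (residue-nonzero 2<p) (Good.det≢0 g₀) S (tag (a , b))
      in line-coordinate-injective nontrivial a<p b<p a′<p b′<p (on-tagged-line g) on′ coordinate≡
      where
      tag≡ : tag (a , b) ≡ tag (a′ , b′)
      tag≡ = cong proj₁ key≡
      on′ : OnLine (line (tag (a , b))) ⌜ a′ , b′ ⌝ₚ
      on′ = subst (λ s → OnLine (line s) ⌜ a′ , b′ ⌝ₚ) (sym tag≡) (on-tagged-line g′)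
      coordinate≡ : line-coordinate (line (tag (a , b))) (a , b)
                      ≡ line-coordinate (line (tag (a , b))) (a′ , b′)
      coordinate≡ = trans (cong proj₂ key≡) (cong (λ s → line-coordinate (line s) (a′ , b′)) (sym tag≡))

    key-injective : ∀ {t t′} → Good t → Good t′ → key t ≡ key t′ → t ≡ t′
    key-injective {a , b , c , d , e} {a′ , b′ , c′ , d′ , e′} g g′ key≡ =
      trans (same-ab⇒same-tuple g (subst (λ (a , b) → Good (a , b , c′ , d′ , e′)) (sym ab≡) g′))
            (cong (λ (a , b) → a , b , c′ , d′ , e′) ab≡)
      where
      ab≡ : (a , b) ≡ (a′ , b′)
      ab≡ = key⇒same-ab g g′ key≡

    key∈ : ∀ {t} → Good t → key t ∈ cartesianProduct booleans residues
    key∈ {a , b , _} g =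
      let a<p , b<p , _ = Good.tuple-below g
      in ∈-cartesianProduct⁺ {xs = booleans} {ys = residues} (∈-booleans (tag (a , b)))
           (∈-upTo⁺ (line-coordinate-below (line (tag (a , b))) a<p b<p))

    good-count : length goodTuples ≤ 2 Nat.* p
    good-count = ≤-trans
      (length-≤-injection key (Uniqueₚ.filter⁺ (T? ∘ good) allTuples-unique)
        (λ t∈ t′∈ → key-injective (good-member t∈) (good-member t′∈)) (key∈ ∘ good-member))
      (≤-reflexive (trans (length-cartesianProduct booleans residues) (cong (2 Nat.*_) (length-upTo p))))

  good-count : length goodTuples ≤ 2 Nat.* p
  good-count = length-≤-if-inhabited goodTuples (λ t∈ → Reference.good-count (good-member t∈))

open Nat using (_+_; _*_; _^_)

counting-bound : ∀ {p G N D} → 4 ≤ p → G ≤ 2 * p → N + D ≡ p * (p * (p * (p * p))) →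
                 D ≤ 2 * (p * (p * (p * p))) → G * p ^ 4 ≤ 4 * N
counting-bound {p} {G} {N} {D} 4≤p G≤2p N+D≡p⁵ D≤2p⁴ = begin
  G * p ^ 4      ≤⟨ *-monoˡ-≤ (p ^ 4) G≤2p ⟩
  2 * p * p ^ 4  ≡⟨ cong (λ x → 2 * p * (p * (p * (p * x)))) (*-identityʳ p) ⟩
  2 * p * p⁴     ≤⟨ +-cancelʳ-≤ (4 * D) (2 * p * p⁴) (4 * N) 2pp⁴+4D≤4N+4D ⟩
  4 * N          ∎
  where
  open ≤-Reasoning
  p⁴ = p * (p * (p * p))
  4D≤2pp⁴ : 4 * D ≤ 2 * p * p⁴
  4D≤2pp⁴ = begin
    4 * D          ≤⟨ *-monoʳ-≤ 4 D≤2p⁴ ⟩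
    4 * (2 * p⁴)   ≡⟨ identity p⁴ ⟩
    2 * 4 * p⁴     ≤⟨ *-monoˡ-≤ p⁴ (*-monoʳ-≤ 2 4≤p) ⟩
    2 * p * p⁴     ∎
    where
    identity : ∀ x → 4 * (2 * x) ≡ 2 * 4 * x
    identity = ℕ-Solver.solve-∀
  2pp⁴+4D≤4N+4D : 2 * p * p⁴ + 4 * D ≤ 4 * N + 4 * D
  2pp⁴+4D≤4N+4D = begin
    2 * p * p⁴ + 4 * D          ≤⟨ +-monoʳ-≤ (2 * p * p⁴) 4D≤2pp⁴ ⟩
    2 * p * p⁴ + 2 * p * p⁴     ≡⟨ identity p p⁴ ⟩
    4 * (p * p⁴)                ≡⟨ cong (4 *_) N+D≡p⁵ ⟨
    4 * (N + D)                 ≡⟨ *-distribˡ-+ 4 N D ⟩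
    4 * N + 4 * D               ∎
    where
    identity : ∀ x y → 2 * x * y + 2 * x * y ≡ 4 * (x * y)
    identity = ℕ-Solver.solve-∀

probability-bound : ∀ {p} .{{_ : NonZero p}} → Prime p → 4 ≤ p → ∀ {P₁ P₂ P₃ P₄} →
  All (PointBelow p) (P₁ ∷ P₂ ∷ P₃ ∷ P₄ ∷ []) → AllPairs _≢_ (P₁ ∷ P₂ ∷ P₃ ∷ P₄ ∷ []) →
  goodCount p P₁ P₂ P₃ P₄ * p ^ 4 ≤ 4 * totalCount p
probability-bound {p} p-prime 4≤p {P₁} {P₂} {P₃} {P₄} below distinct =
  counting-bound 4≤p good-count (trans (length-filterᵇ-partition (nondeg p) (allTuples p)) length-allTuples)
    degenerate-count
  where
  open TupleCount p-prime
  open GoodTuples p-prime (≤-trans (s≤s (s≤s (s≤s z≤n))) 4≤p) P₁ P₂ P₃ P₄ below distinct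

lemma1p7 : ∃[ C ] (0 < C × (∀ (n : ℕ) → 1 ≤ n → ∀ (p : ℕ) → .{{_ : NonZero p}} → Prime p →
    4 * n < p → p < 8 * n →
    ∀ (x₁ y₁ x₂ y₂ x₃ y₃ x₄ y₄ : ℕ) →
    x₁ < n → y₁ < n → x₂ < n → y₂ < n → x₃ < n → y₃ < n → x₄ < n → y₄ < n →
    (x₁ , y₁) ≢ (x₂ , y₂) → (x₁ , y₁) ≢ (x₃ , y₃) → (x₁ , y₁) ≢ (x₄ , y₄) →
    (x₂ , y₂) ≢ (x₃ , y₃) → (x₂ , y₂) ≢ (x₄ , y₄) → (x₃ , y₃) ≢ (x₄ , y₄) →
    goodCount p (x₁ , y₁) (x₂ , y₂) (x₃ , y₃) (x₄ , y₄) * p ^ 4 ≤ C * totalCount p))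
lemma1p7 = 4 , s≤s z≤n ,
  λ n 1≤n p p-prime 4n<p _ x₁ y₁ x₂ y₂ x₃ y₃ x₄ y₄
    x₁<n y₁<n x₂<n y₂<n x₃<n y₃<n x₄<n y₄<n d₁₂ d₁₃ d₁₄ d₂₃ d₂₄ d₃₄ →
    let n<p : ∀ {x} → x < n → x < p
        n<p x<n = <-trans x<n (≤-<-trans (m≤n*m n 4) 4n<p)
    in probability-bound p-prime (<⇒≤ (≤-<-trans (*-monoʳ-≤ 4 1≤n) 4n<p))
         ((n<p x₁<n , n<p y₁<n) ∷ (n<p x₂<n , n<p y₂<n) ∷ (n<p x₃<n , n<p y₃<n)
           ∷ (n<p x₄<n , n<p y₄<n) ∷ [])
         ((d₁₂ ∷ d₁₃ ∷ d₁₄ ∷ []) ∷ (d₂₃ ∷ d₂₄ ∷ []) ∷ (d₃₄ ∷ []) ∷ [] ∷ [])
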